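{- Bob wins the feedback game on every Eulerian double wheel graph, for every choice of starting vertex.
   Context: An Eulerian double wheel is the graph consisting of a cycle $C_k=v_0v_1\dots v_{k-1}$ with $k\ge4$ even, together with two further vertices $x,y$ each adjacent to all vertices of the cycle (and not to each other); equivalently, an Eulerian triangulation of the sphere with $k+2\ge6$ vertices and degree sequence $(4,\dots,4,k,k)$. The feedback game on a connected graph $G$ with a starting vertex $s$: a token is placed on $s$; two players, Alice (who moves first) and Bob, alternately move the token from its current vertex $u$ to a vertex $v$ adjacent to $u$, and the edge $uv$ is then deleted. The first player who moves the token back to $s$, or to a vertex that is isolated after deletion of the edge just used, wins. "X wins the game" means X has a winning strategy. -}

module Defs where

open import Data.Nat using (ℕ; zero; suc; _+_; _*_; _%_; _<_)
open import Data.Fin using (Fin; toℕ; fromℕ<)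
open import Data.Fin.Properties renaming (_≟_ to _≟F_)
open import Data.Bool using (Bool; true; false; _∨_; _∧_; if_then_else_; not)
open import Data.Product using (_×_)
open import Data.Sum using (_⊎_)
open import Relation.Nullary using (¬_; Dec; yes; no)
open import Relation.Nullary.Decidable using (⌊_⌋)
open import Relation.Binary.PropositionalEquality using (_≡_; refl; cong)
open import Relation.Binary.Definitions using (DecidableEquality)

-- Graphs given by a symmetric Boolean adjacency function on a vertex
-- type with decidable equality; the edge set of the current position
-- of the feedback game is such a function.

EdgeSet : Set → Set
EdgeSet V = V → V → Bool

module FeedbackGame {V : Set} (_≟_ : DecidableEquality V) where

  samePair : V → V → V → V → Bool
  samePair u v a b = (⌊ a ≟ u ⌋ ∧ ⌊ b ≟ v ⌋) ∨ (⌊ a ≟ v ⌋ ∧ ⌊ b ≟ u ⌋)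

  delete : EdgeSet V → V → V → EdgeSet V
  delete E u v a b = if samePair u v a b then false else E a b

  Isolated : EdgeSet V → V → Set
  Isolated E v = ∀ w → E v w ≡ false

  -- Positions: start vertex s (fixed), current edge set E, token at u.
  -- MoverWins s E u  : the player about to move has a winning strategy.
  -- Inductive definitions = well-founded strategy trees; the game is
  -- finite since every move deletes an edge.
  data MoverWins (s : V) : EdgeSet V → V → Set
  data MoverLoses (s : V) : EdgeSet V → V → Set

  data MoverWins s where
    winNow : ∀ {E u} (v : V) → E u v ≡ true →
             (v ≡ s ⊎ Isolated (delete E u v) v) → MoverWins s E u
    winLater : ∀ {E u} (v : V) → E u v ≡ true →
             MoverLoses s (delete E u v) v → MoverWins s E u

  data MoverLoses s where
    loses : ∀ {E u} →
            (∀ v → E u v ≡ true →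
               (¬ (v ≡ s)) × (¬ Isolated (delete E u v) v) ×
               MoverWins s (delete E u v) v) →
            MoverLoses s E u

  BobWins : EdgeSet V → V → Set
  BobWins G s = MoverLoses s G s

data DWVertex (k : ℕ) : Set where
  rim : Fin k → DWVertex k
  hubX : DWVertex k
  hubY : DWVertex k

_≟DW_ : ∀ {k} → DecidableEquality (DWVertex k)
rim i ≟DW rim j with i ≟F j
... | yes refl = yes refl
... | no ne = no λ { refl → ne refl }
rim i ≟DW hubX = no λ ()
rim i ≟DW hubY = no λ ()
hubX ≟DW rim j = no λ ()
hubX ≟DW hubX = yes refl
hubX ≟DW hubY = no λ ()
hubY ≟DW rim j = no λ ()
hubY ≟DW hubX = no λ ()
hubY ≟DW hubY = yes refl

isSucc : ∀ {k} → Fin k → Fin k → Bool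
isSucc {zero} ()
isSucc {suc n} i j = ⌊ toℕ j Data.Nat.≟ ((toℕ i + 1) % suc n) ⌋
  where import Data.Nat

doubleWheel : (k : ℕ) → EdgeSet (DWVertex k)
doubleWheel k (rim i) (rim j) = isSucc i j ∨ isSucc j i
doubleWheel k (rim i) hubX = true
doubleWheel k (rim i) hubY = true
doubleWheel k hubX (rim j) = true
doubleWheel k hubY (rim j) = true
doubleWheel k hubX hubX = false
doubleWheel k hubX hubY = false
doubleWheel k hubY hubX = false
doubleWheel k hubY hubY = false

module Submission where

open import Defs
open import Data.Nat using (ℕ; zero; suc; _+_; _*_; _%_; _≤_; _<_; z≤n; s≤s)
import Data.Nat as ℕ
open import Data.Nat.Properties
  using (≤-refl; ≤-trans; <-trans; ≤-pred; <⇒≤; <-irrefl; n≤1+n; n<1+n; ≤-reflexive; m+n≤o⇒n≤o;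
         suc-injective; +-suc; +-assoc; +-comm; +-identityʳ)
open import Data.Nat.DivMod using (m%n<n; m<n⇒m%n≡m; [m+n]%n≡m%n; [m+kn]%n≡m%n; %-distribˡ-+; %-distribˡ-*; m%n%n≡m%n)
open import Data.Nat.Tactic.RingSolver using (solve-∀)
open import Data.Fin using (Fin; toℕ; fromℕ<)
open import Data.Fin.Properties using (toℕ-fromℕ<; toℕ-injective; toℕ<n)
open import Data.Bool using (Bool; true; false; _∨_; _∧_; if_then_else_)
open import Data.Bool.Properties using (∨-comm; ∧-comm)
open import Data.Empty using (⊥-elim)
open import Data.Product using (_×_; _,_)
open import Data.Sum using (_⊎_; inj₁; inj₂)
open import Relation.Nullary using (¬_; Dec; yes; no)
open import Relation.Nullary.Decidable using (⌊_⌋; isYes≗does; dec-true; dec-false)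
open import Relation.Binary.PropositionalEquality
  using (_≡_; _≢_; refl; sym; trans; cong; cong₂; subst; subst₂; module ≡-Reasoning)
open import Relation.Binary.Definitions using (DecidableEquality)

-- From a hub: the hubs are
-- twins, so Alice s → v, Bob v → other hub, Alice → v' ≠ v, Bob v' → s.
-- From s = ν 0 on the rim ν 0, ν 1, …: after Alice's s → ν 1 Bob
-- "marches", answering each step ν a → ν (a + 1) by ν (a + 1) → ν (a + 2);
-- as k is even, Alice reaches ν (k - 1) and Bob closes the cycle to s,
-- while her other moves use dead edges or reach a hub, whence Bob returns
-- to s.  After Alice's s → h₁, Bob plays h₁ → ν 2 and marches likewise,
-- meeting ν a → h₁ by h₁ → ν 3, a trap whose only exit leads to h₂.
-- Openings to ν (k - 1) or h₂ are the same after reflecting or swapping.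

⌊⌋-true : ∀ {A : Set} (a? : Dec A) → A → ⌊ a? ⌋ ≡ true
⌊⌋-true a? a = trans (isYes≗does a?) (dec-true a? a)

⌊⌋-false : ∀ {A : Set} (a? : Dec A) → ¬ A → ⌊ a? ⌋ ≡ false
⌊⌋-false a? ¬a = trans (isYes≗does a?) (dec-false a? ¬a)

present-absent : ∀ {A : Set} {b : Bool} → b ≡ true → b ≡ false → A
present-absent refl ()

-- Edge deletion and the feedback game on an arbitrary graph.
module GameFacts {V : Set} (_≟_ : DecidableEquality V) where
  open FeedbackGame _≟_

  Symmetric : EdgeSet V → Set
  Symmetric E = ∀ a b → E a b ≡ E b a

  samePair-symmetric : ∀ u v a b → samePair u v a b ≡ samePair u v b a
  samePair-symmetric u v a b =
    trans (∨-comm (⌊ a ≟ u ⌋ ∧ ⌊ b ≟ v ⌋) _)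
          (cong₂ _∨_ (∧-comm ⌊ a ≟ v ⌋ ⌊ b ≟ u ⌋) (∧-comm ⌊ a ≟ u ⌋ ⌊ b ≟ v ⌋))

  delete-⊆ : ∀ E u v a b → delete E u v a b ≡ true → E a b ≡ true
  delete-⊆ E u v a b with samePair u v a b
  ... | false = λ e → e

  delete-absent : ∀ E u v a b → E a b ≡ false → delete E u v a b ≡ false
  delete-absent E u v a b with samePair u v a b
  ... | true  = λ _ → refl
  ... | false = λ e → e

  samePair-outside : ∀ {u v a} b → a ≢ u → a ≢ v → samePair u v a b ≡ false
  samePair-outside {u} {v} {a} b a≢u a≢v rewrite ⌊⌋-false (a ≟ u) a≢u | ⌊⌋-false (a ≟ v) a≢v = refl

  delete-outside : ∀ E {u v a b} → samePair u v a b ≡ false → delete E u v a b ≡ E a b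
  delete-outside E {a = a} {b} different = cong (λ c → if c then false else E a b) different

  delete-keepsˡ : ∀ E {u v a} b → a ≢ u → a ≢ v → delete E u v a b ≡ E a b
  delete-keepsˡ E b a≢u a≢v = delete-outside E (samePair-outside b a≢u a≢v)

  delete-keepsʳ : ∀ E {u v} a {b} → b ≢ u → b ≢ v → delete E u v a b ≡ E a b
  delete-keepsʳ E {u} {v} a {b} b≢u b≢v =
    delete-outside E (trans (samePair-symmetric u v a b) (samePair-outside a b≢u b≢v))

  delete-removes : ∀ E u v → delete E u v u v ≡ false
  delete-removes E u v rewrite ⌊⌋-true (u ≟ u) refl | ⌊⌋-true (v ≟ v) refl = refl

  delete-removes-reversed : ∀ E u v → delete E u v v u ≡ false
  delete-removes-reversed E u v
    rewrite samePair-symmetric u v v u | ⌊⌋-true (u ≟ u) refl | ⌊⌋-true (v ≟ v) refl = refl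

  delete-symmetric : ∀ {E} u v → Symmetric E → Symmetric (delete E u v)
  delete-symmetric u v sym-E a b rewrite samePair-symmetric u v a b | sym-E a b = refl

  walk₂ : EdgeSet V → V → V → V → EdgeSet V
  walk₂ E x y z = delete (delete E x y) y z

  walk₂-⊆ : ∀ E x y z a b → walk₂ E x y z a b ≡ true → E a b ≡ true
  walk₂-⊆ E x y z a b e = delete-⊆ E x y a b (delete-⊆ (delete E x y) y z a b e)

  walk₂-absent : ∀ E x y z {a b} → E a b ≡ false → walk₂ E x y z a b ≡ false
  walk₂-absent E x y z {a} {b} e = delete-absent (delete E x y) y z a b (delete-absent E x y a b e)

  walk₂-keepsˡ : ∀ E {x y z a} b → a ≢ x → a ≢ y → a ≢ z → walk₂ E x y z a b ≡ E a b
  walk₂-keepsˡ E {x} {y} b a≢x a≢y a≢z =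
    trans (delete-keepsˡ (delete E x y) b a≢y a≢z) (delete-keepsˡ E b a≢x a≢y)

  walk₂-keepsʳ : ∀ E {x y z} a {b} → b ≢ x → b ≢ y → b ≢ z → walk₂ E x y z a b ≡ E a b
  walk₂-keepsʳ E {x} {y} a b≢x b≢y b≢z =
    trans (delete-keepsʳ (delete E x y) a b≢y b≢z) (delete-keepsʳ E a b≢x b≢y)

  walk₂-symmetric : ∀ {E} x y z → Symmetric E → Symmetric (walk₂ E x y z)
  walk₂-symmetric x y z sym-E = delete-symmetric y z (delete-symmetric x y sym-E)

  Answered : V → EdgeSet V → V → V → Set
  Answered s E u w = (¬ w ≡ s) × MoverWins s (delete E u w) w

  wins-not-isolated : ∀ {s E u} → MoverWins s E u → ¬ Isolated E u
  wins-not-isolated (winNow v e _)   isolated = present-absent e (isolated v)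
  wins-not-isolated (winLater v e _) isolated = present-absent e (isolated v)

  losing-position : ∀ {s E u} → (∀ w → E u w ≡ true → Answered s E u w) → MoverLoses s E u
  losing-position answer = loses λ w e → let (w≢s , wins) = answer w e in
    w≢s , wins-not-isolated wins , wins

  answer-by-return : ∀ {s E u w} → s ≢ u → s ≢ w → E w s ≡ true → Answered s E u w
  answer-by-return {s} {E} {w = w} s≢u s≢w e =
    (λ w≡s → s≢w (sym w≡s)) , winNow s (trans (delete-keepsʳ E w s≢u s≢w) e) (inj₁ refl)

  CommonNeighbour : EdgeSet V → V → V → V → Set
  CommonNeighbour G h h' w = (w ≢ h) × (w ≢ h') × (G w h ≡ true) × (G w h' ≡ true)

  -- Bob wins from a vertex h with a twin h' (all neighbours of h and of
  -- h' are common neighbours): Alice h → w, Bob w → h', Alice h' → w',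
  -- where w' ≢ w because the edge w h' is gone, and Bob w' → h.
  twin-start : ∀ {G h h'} → h ≢ h' →
               (∀ w → G h w ≡ true → CommonNeighbour G h h' w) →
               (∀ w → G h' w ≡ true → CommonNeighbour G h h' w) →
               BobWins G h
  twin-start {G} {h} {h'} h≢h' common common' = losing-position answer
    where
      answer : ∀ w → G h w ≡ true → Answered h G h w
      answer w e with common w e
      ... | w≢h , w≢h' , _ , wh' = w≢h , winLater h' to-twin (losing-position answer')
        where
          to-twin : delete G h w w h' ≡ true
          to-twin = trans (delete-keepsʳ G w (λ p → h≢h' (sym p)) (λ p → w≢h' (sym p))) wh'
          answer' : ∀ w' → walk₂ G h w h' h' w' ≡ true → Answered h (walk₂ G h w h') h' w'
          answer' w' e' with common' w' (walk₂-⊆ G h w h' h' w' e')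
          ... | w'≢h , w'≢h' , w'h , _ =
            answer-by-return h≢h' (λ p → w'≢h (sym p)) (trans (walk₂-keepsˡ G h w'≢h w'≢w w'≢h') w'h)
            where
              w'≢w : w' ≢ w
              w'≢w refl = present-absent e' (delete-removes-reversed (delete G h w) w h')

-- Bob's strategy on any graph G presented as a double wheel with rim
-- length k = K + 1.
module DoubleWheelStrategy {V : Set} (_≟_ : DecidableEquality V) (G : EdgeSet V) (K : ℕ) where
  open FeedbackGame _≟_
  open GameFacts _≟_

  k : ℕ
  k = suc K

  -- A presentation of G as a double wheel: hubs h₁, h₂ and rim
  -- ν 0, ν 1, … (indices read modulo k); ν a is adjacent to both hubs
  -- and otherwise only to its rim neighbours ν (a + 1) and ν (a + K).
  record Frame : Set where
    field
      h₁ h₂          : V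
      ν              : ℕ → V
      h₁≢h₂          : h₁ ≢ h₂
      rim≢h₁         : ∀ a → ν a ≢ h₁
      rim≢h₂         : ∀ a → ν a ≢ h₂
      periodic       : ∀ a → ν (a + k) ≡ ν a
      injective      : ∀ {a b} → a < k → b < k → ν a ≡ ν b → a ≡ b
      symmetric      : Symmetric G
      rim-edge       : ∀ a → G (ν a) (ν (suc a)) ≡ true
      spoke₁         : ∀ a → G (ν a) h₁ ≡ true
      spoke₂         : ∀ a → G (ν a) h₂ ≡ true
      rim-neighbours : ∀ a w → G (ν a) w ≡ true →
                       w ≡ h₁ ⊎ w ≡ h₂ ⊎ w ≡ ν (suc a) ⊎ w ≡ ν (a + K)

  swap-hubs : Frame → Frame
  swap-hubs F = record
    { h₁ = h₂ ; h₂ = h₁ ; ν = ν ; h₁≢h₂ = λ p → h₁≢h₂ (sym p)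
    ; rim≢h₁ = rim≢h₂ ; rim≢h₂ = rim≢h₁ ; periodic = periodic ; injective = injective
    ; symmetric = symmetric ; rim-edge = rim-edge ; spoke₁ = spoke₂ ; spoke₂ = spoke₁
    ; rim-neighbours = λ a w e → swap (rim-neighbours a w e) }
    where
      open Frame F
      swap : ∀ {w x y} → w ≡ h₁ ⊎ w ≡ h₂ ⊎ w ≡ x ⊎ w ≡ y → w ≡ h₂ ⊎ w ≡ h₁ ⊎ w ≡ x ⊎ w ≡ y
      swap (inj₁ p)        = inj₂ (inj₁ p)
      swap (inj₂ (inj₁ p)) = inj₁ p
      swap (inj₂ (inj₂ p)) = inj₂ (inj₂ p)

  module Strategy (F : Frame) (r₀ : ℕ) (even : r₀ + r₀ + 4 ≡ k) where
    open Frame F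

    s : V
    s = ν 0

    4≤k : 4 ≤ k
    4≤k = m+n≤o⇒n≤o (r₀ + r₀) (≤-reflexive even)

    1<k : 1 < k
    1<k = ≤-trans (s≤s (s≤s z≤n)) 4≤k

    2<k : 2 < k
    2<k = ≤-trans (s≤s (s≤s (s≤s z≤n))) 4≤k

    2<K : 2 < K
    2<K = ≤-pred 4≤k

    ν-distinct : ∀ {x y} → x < y → y < k → ν x ≢ ν y
    ν-distinct x<y y<k e = <-irrefl (injective (<-trans x<y y<k) y<k e) x<y

    ν-distinct⁻ : ∀ {x y} → x < y → y < k → ν y ≢ ν x
    ν-distinct⁻ x<y y<k e = ν-distinct x<y y<k (sym e)

    ν-back : ∀ a → ν (suc a + K) ≡ ν a
    ν-back a = trans (cong ν (sym (+-suc a K))) (periodic a)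

    rim-moves-keep-spoke : ∀ E x y z j {h} → (∀ i → ν i ≢ h) →
                           walk₂ E (ν x) (ν y) (ν z) (ν j) h ≡ E (ν j) h
    rim-moves-keep-spoke E x y z j off-rim =
      walk₂-keepsʳ E (ν j) (λ p → off-rim x (sym p)) (λ p → off-rim y (sym p)) (λ p → off-rim z (sym p))

    -- Whoever has just moved forward to ν (a + 1) cannot step back.
    no-way-back : ∀ E x a → walk₂ E x (ν a) (ν (suc a)) (ν (suc a)) (ν (suc a + K)) ≡ false
    no-way-back E x a = subst (λ y → walk₂ E x (ν a) (ν (suc a)) (ν (suc a)) y ≡ false) (sym (ν-back a))
                              (delete-removes-reversed (delete E x (ν a)) (ν a) (ν (suc a)))

    -- Alice is to move at ν a, and the rim path ν a, ν (a + 1), …, ν K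
    -- ahead of her, as well as the closing edge ν K s, are intact.
    record Track (a : ℕ) (E : EdgeSet V) : Set where
      field
        sym-E   : Symmetric E
        ⊆G      : ∀ x y → E x y ≡ true → G x y ≡ true
        ahead   : ∀ j → a ≤ j → suc (suc j) < k → E (ν j) (ν (suc j)) ≡ true
        closing : E (ν K) s ≡ true

    advance : ℕ → EdgeSet V → EdgeSet V
    advance a E = walk₂ E (ν a) (ν (suc a)) (ν (suc (suc a)))

    track-advance : ∀ {a E} → 1 ≤ a → suc (suc (suc a)) < k → Track a E →
                    Track (suc (suc a)) (advance a E)
    track-advance {a} {E} 1≤a a+3<k track = record
      { sym-E   = walk₂-symmetric _ _ _ sym-E
      ; ⊆G      = λ x y e → ⊆G x y (walk₂-⊆ E _ _ _ x y e)
      ; ahead   = λ j a+2≤j j+2<k →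
          let j+1<k = <-trans (n<1+n (suc j)) j+2<k in
          trans (walk₂-keepsʳ E (ν j) (ν-distinct⁻ (s≤s (m+n≤o⇒n≤o 2 a+2≤j)) j+1<k)
                                      (ν-distinct⁻ (s≤s (m+n≤o⇒n≤o 1 a+2≤j)) j+1<k)
                                      (ν-distinct⁻ (s≤s a+2≤j) j+1<k))
                (ahead j (m+n≤o⇒n≤o 2 a+2≤j) j+2<k)
      ; closing = trans (walk₂-keepsʳ E (ν K) (ν-distinct 1≤a a<k) (ν-distinct (s≤s z≤n) a+1<k)
                                              (ν-distinct (s≤s z≤n) a+2<k))
                        closing
      }
      where
        open Track track
        a+2<k : suc (suc a) < k
        a+2<k = <-trans (n<1+n _) a+3<k
        a+1<k : suc a < k
        a+1<k = <-trans (n<1+n _) a+2<k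
        a<k : a < k
        a<k = <-trans (n<1+n _) a+1<k

    opening-track : ∀ y → (∀ j → 2 ≤ j → j < k → ν j ≢ y) → Track 2 (walk₂ G s y (ν 2))
    opening-track y off-path = record
      { sym-E   = walk₂-symmetric s y (ν 2) symmetric
      ; ⊆G      = walk₂-⊆ G s y (ν 2)
      ; ahead   = λ j 2≤j j+2<k →
          let j+1<k = <-trans (n<1+n _) j+2<k in
          trans (walk₂-keepsʳ G (ν j) (ν-distinct⁻ (s≤s z≤n) j+1<k)
                                      (off-path (suc j) (m+n≤o⇒n≤o 1 (s≤s 2≤j)) j+1<k)
                                      (ν-distinct⁻ (s≤s 2≤j) j+1<k))
                (rim-edge j)
      ; closing =
          trans (walk₂-keepsˡ G s (ν-distinct⁻ (<-trans (s≤s z≤n) 2<K) K<k) (off-path K (<⇒≤ 2<K) K<k)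
                                  (ν-distinct⁻ 2<K K<k))
                (trans (cong (G (ν K)) (sym (periodic 0))) (rim-edge K))
      }
      where
        K<k : K < k
        K<k = n<1+n K

    -- Alice's moves other than the forward step ν a → ν (a + 1) must be
    -- answered, and the side condition must survive a round of the march.
    SideMoves : (ℕ → EdgeSet V → Set) → Set
    SideMoves Side = ∀ {a E} → 1 ≤ a → suc a < k → Track a E → Side a E →
                     ∀ w → E (ν a) w ≡ true → w ≢ ν (suc a) → Answered s E (ν a) w

    SideAdvance : (ℕ → EdgeSet V → Set) → Set
    SideAdvance Side = ∀ {a E} → 1 ≤ a → suc (suc (suc a)) < k → Track a E → Side a E →
                       Side (suc (suc a)) (advance a E)

    two-more : ∀ r c → r + r + suc (suc c) ≡ suc r + suc r + c
    two-more = solve-∀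

    -- The march: Bob answers each forward step ν a → ν (a + 1) by
    -- ν (a + 1) → ν (a + 2).  As k − a = 2 r + 2 is even, it is Alice who
    -- finally steps onto ν K, and Bob closes the cycle to s.
    march : ∀ {Side} → SideMoves Side → SideAdvance Side →
            ∀ r {a E} → r + r + suc (suc a) ≡ k → 1 ≤ a → Track a E → Side a E →
            MoverLoses s E (ν a)
    march side-moves side-advance r {a} {E} remaining 1≤a track side = losing-position answer
      where
        open Track track
        a+1<k : suc a < k
        a+1<k = m+n≤o⇒n≤o (r + r) (≤-reflexive remaining)
        s≢a : s ≢ ν a
        s≢a = ν-distinct 1≤a (<-trans (n<1+n a) a+1<k)
        s≢a+1 : s ≢ ν (suc a)
        s≢a+1 = ν-distinct (s≤s z≤n) a+1<k

        forward : ∀ r → r + r + suc (suc a) ≡ k → Answered s E (ν a) (ν (suc a))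
        forward zero remaining = answer-by-return s≢a s≢a+1
          (subst (λ i → E (ν i) s ≡ true) (sym (suc-injective remaining)) closing)
        forward (suc r) remaining =
          (λ p → s≢a+1 (sym p)) ,
          winLater (ν (suc (suc a))) step
            (march side-moves side-advance r remaining' (s≤s z≤n)
                   (track-advance 1≤a a+3<k track) (side-advance 1≤a a+3<k track side))
          where
            remaining' : r + r + suc (suc (suc (suc a))) ≡ k
            remaining' = trans (two-more r (suc (suc a))) remaining
            a+3<k : suc (suc (suc a)) < k
            a+3<k = m+n≤o⇒n≤o (r + r) (≤-reflexive remaining')
            a+2<k : suc (suc a) < k
            a+2<k = <-trans (n<1+n _) a+3<k
            step : delete E (ν a) (ν (suc a)) (ν (suc a)) (ν (suc (suc a))) ≡ true
            step = trans (delete-keepsʳ E (ν (suc a)) (ν-distinct⁻ (s≤s (n≤1+n a)) a+2<k)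
                                                      (ν-distinct⁻ (n<1+n _) a+2<k))
                         (ahead (suc a) (n≤1+n a) a+3<k)

        answer : ∀ w → E (ν a) w ≡ true → Answered s E (ν a) w
        answer w e with w ≟ ν (suc a)
        ... | yes refl = forward r remaining
        ... | no w≢a+1 = side-moves 1≤a a+1<k track side w e w≢a+1

    answer-at-hub : ∀ {a E h} → 1 ≤ a → suc a < k → s ≢ h → Track a E → E s h ≡ true →
                    Answered s E (ν a) h
    answer-at-hub 1≤a a+1<k s≢h track e =
      answer-by-return (ν-distinct 1≤a (<-trans (n<1+n _) a+1<k)) s≢h (trans (Track.sym-E track _ _) e)

    record RimSide (a : ℕ) (E : EdgeSet V) : Set where
      field
        spokes₁ : ∀ j → E (ν j) h₁ ≡ true
        spokes₂ : ∀ j → E (ν j) h₂ ≡ true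
        behind  : E (ν a) (ν (a + K)) ≡ false

    rim-side-moves : SideMoves RimSide
    rim-side-moves {a} 1≤a a+1<k track side w e w≢a+1 with rim-neighbours a w (Track.⊆G track _ _ e)
    ... | inj₁ refl               = answer-at-hub 1≤a a+1<k (rim≢h₁ 0) track (RimSide.spokes₁ side 0)
    ... | inj₂ (inj₁ refl)        = answer-at-hub 1≤a a+1<k (rim≢h₂ 0) track (RimSide.spokes₂ side 0)
    ... | inj₂ (inj₂ (inj₁ refl)) = ⊥-elim (w≢a+1 refl)
    ... | inj₂ (inj₂ (inj₂ refl)) = present-absent e (RimSide.behind side)

    rim-side-advance : SideAdvance RimSide
    rim-side-advance {a} {E} _ _ _ side = record
      { spokes₁ = λ j → trans (rim-moves-keep-spoke E _ _ _ j rim≢h₁) (spokes₁ j)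
      ; spokes₂ = λ j → trans (rim-moves-keep-spoke E _ _ _ j rim≢h₂) (spokes₂ j)
      ; behind  = no-way-back E (ν a) (suc a)
      }
      where open RimSide side

    rim-walk : MoverWins s (delete G s (ν 1)) (ν 1)
    rim-walk = winLater (ν 2) step
      (march rim-side-moves rim-side-advance r₀ even (s≤s z≤n)
             (opening-track (ν 1) (λ j 2≤j j<k → ν-distinct⁻ 2≤j j<k)) side)
      where
        step : delete G s (ν 1) (ν 1) (ν 2) ≡ true
        step = trans (delete-keepsʳ G (ν 1) (ν-distinct⁻ (s≤s z≤n) 2<k) (ν-distinct⁻ (n<1+n 1) 2<k))
                     (rim-edge 1)
        side : RimSide 2 (walk₂ G s (ν 1) (ν 2))
        side = record
          { spokes₁ = λ j → trans (rim-moves-keep-spoke G 0 1 2 j rim≢h₁) (spoke₁ j)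
          ; spokes₂ = λ j → trans (rim-moves-keep-spoke G 0 1 2 j rim≢h₂) (spoke₂ j)
          ; behind  = no-way-back G s 1
          }

    data FanPhase (a : ℕ) (E : EdgeSet V) : Set where
      at-two     : a ≡ 2 → E (ν 2) h₁ ≡ false → FanPhase a E
      -- Alice cannot step back, and ν 3 is a trap: of its edges only
      -- the spokes remain.
      trap-ready : 4 ≤ a → E (ν a) (ν (a + K)) ≡ false →
                   E (ν 3) h₁ ≡ true → E (ν 3) (ν 2) ≡ false → E (ν 3) (ν 4) ≡ false →
                   FanPhase a E

    record FanSide (a : ℕ) (E : EdgeSet V) : Set where
      field
        spokes₂        : ∀ j → E (ν j) h₂ ≡ true
        spokes₁-ahead  : ∀ j → a < j → j < k → E (ν j) h₁ ≡ true
        first-rim-edge : E (ν 1) s ≡ true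
        phase          : FanPhase a E

    -- Alice at ν a (a ≥ 4) moves to h₁; Bob springs the trap h₁ → ν 3,
    -- where Alice's only move, to h₂, is answered by returning to s.
    spring-trap : ∀ {a E} → 4 ≤ a → a < k → Track a E → FanSide a E →
                  E (ν 3) h₁ ≡ true → E (ν 3) (ν 2) ≡ false → E (ν 3) (ν 4) ≡ false →
                  Answered s E (ν a) h₁
    spring-trap {a} {E} 4≤a a<k track side spoke no-back no-ahead =
      (λ p → rim≢h₁ 0 (sym p)) , winLater (ν 3) to-trap (losing-position answer)
      where
        open Track track
        3<k : 3 < k
        3<k = <-trans 4≤a a<k
        to-trap : delete E (ν a) h₁ h₁ (ν 3) ≡ true
        to-trap = trans (delete-keepsʳ E h₁ (ν-distinct 4≤a a<k) (rim≢h₁ 3)) (trans (sym-E h₁ (ν 3)) spoke)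
        E₂ : EdgeSet V
        E₂ = walk₂ E (ν a) h₁ (ν 3)
        answer : ∀ w → E₂ (ν 3) w ≡ true → Answered s E₂ (ν 3) w
        answer w e with rim-neighbours 3 w (⊆G _ _ (walk₂-⊆ E _ _ _ _ _ e))
        ... | inj₁ refl               = present-absent e (delete-removes-reversed (delete E (ν a) h₁) h₁ (ν 3))
        ... | inj₂ (inj₁ refl)        =
          answer-by-return (ν-distinct (s≤s z≤n) 3<k) (rim≢h₂ 0)
            (trans (walk₂-keepsʳ E h₂ (ν-distinct (≤-trans (s≤s z≤n) 4≤a) a<k) (rim≢h₁ 0) (ν-distinct (s≤s z≤n) 3<k))
                   (trans (sym-E h₂ s) (FanSide.spokes₂ side 0)))
        ... | inj₂ (inj₂ (inj₁ refl)) = present-absent (walk₂-⊆ E _ _ _ _ _ e) no-ahead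
        ... | inj₂ (inj₂ (inj₂ refl)) =
          present-absent (walk₂-⊆ E _ _ _ _ _ (subst (λ y → E₂ (ν 3) y ≡ true) (ν-back 2) e)) no-back

    fan-side-moves : SideMoves FanSide
    fan-side-moves {a} {E} 1≤a a+1<k track side w e w≢a+1
      with rim-neighbours a w (Track.⊆G track _ _ e) | FanSide.phase side
    ... | inj₁ refl               | at-two refl gone = present-absent e gone
    ... | inj₁ refl               | trap-ready 4≤a _ spoke no-back no-ahead =
      spring-trap 4≤a (<-trans (n<1+n a) a+1<k) track side spoke no-back no-ahead
    ... | inj₂ (inj₁ refl)        | _ = answer-at-hub 1≤a a+1<k (rim≢h₂ 0) track (FanSide.spokes₂ side 0)
    ... | inj₂ (inj₂ (inj₁ refl)) | _ = ⊥-elim (w≢a+1 refl)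
    ... | inj₂ (inj₂ (inj₂ refl)) | trap-ready _ behind _ _ _ = present-absent e behind
    ... | inj₂ (inj₂ (inj₂ refl)) | at-two refl _ =
      answer-by-return (ν-distinct (s≤s z≤n) 2<k) (λ p → ν-distinct (s≤s z≤n) 1<k (trans p (ν-back 1)))
        (subst (λ y → E y s ≡ true) (sym (ν-back 1)) (FanSide.first-rim-edge side))

    fan-side-advance : SideAdvance FanSide
    fan-side-advance {a} {E} 1≤a a+3<k track side = record
      { spokes₂        = λ j → trans (rim-moves-keep-spoke E _ _ _ j rim≢h₂) (spokes₂ j)
      ; spokes₁-ahead  = λ j a+2<j j<k →
          trans (rim-moves-keep-spoke E _ _ _ j rim≢h₁) (spokes₁-ahead j (m+n≤o⇒n≤o 2 a+2<j) j<k)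
      ; first-rim-edge =
          trans (walk₂-keepsʳ E (ν 1) (ν-distinct 1≤a a<k) (ν-distinct (s≤s z≤n) a+1<k)
                                      (ν-distinct (s≤s z≤n) a+2<k))
                first-rim-edge
      ; phase          = next-phase phase
      }
      where
        open FanSide side
        a+2<k : suc (suc a) < k
        a+2<k = <-trans (n<1+n _) a+3<k
        a+1<k : suc a < k
        a+1<k = <-trans (n<1+n _) a+2<k
        a<k : a < k
        a<k = <-trans (n<1+n _) a+1<k
        next-phase : FanPhase a E → FanPhase (suc (suc a)) (advance a E)
        next-phase (at-two refl _) =
          trap-ready ≤-refl (no-way-back E (ν 2) 3)
            (trans (rim-moves-keep-spoke E 2 3 4 3 rim≢h₁) (spokes₁-ahead 3 ≤-refl (m+n≤o⇒n≤o 2 a+3<k)))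
            (delete-absent (delete E (ν 2) (ν 3)) (ν 3) (ν 4) (ν 3) (ν 2) (delete-removes-reversed E (ν 2) (ν 3)))
            (delete-removes (delete E (ν 2) (ν 3)) (ν 3) (ν 4))
        next-phase (trap-ready 4≤a _ spoke no-back no-ahead) =
          trap-ready (m+n≤o⇒n≤o 2 (s≤s (s≤s 4≤a)) ) (no-way-back E (ν a) (suc a))
            (trans (rim-moves-keep-spoke E _ _ _ 3 rim≢h₁) spoke)
            (walk₂-absent E _ _ _ no-back) (walk₂-absent E _ _ _ no-ahead)

    fan-walk : MoverWins s (delete G s h₁) h₁
    fan-walk = winLater (ν 2) step
      (march fan-side-moves fan-side-advance r₀ even (s≤s z≤n)
             (opening-track h₁ (λ j _ _ → rim≢h₁ j)) side)
      where
        step : delete G s h₁ h₁ (ν 2) ≡ true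
        step = trans (delete-keepsʳ G h₁ (ν-distinct⁻ (s≤s z≤n) 2<k) (rim≢h₁ 2))
                     (trans (symmetric h₁ (ν 2)) (spoke₁ 2))
        side : FanSide 2 (walk₂ G s h₁ (ν 2))
        side = record
          { spokes₂        = λ j → trans (walk₂-keepsʳ G (ν j) (λ p → rim≢h₂ 0 (sym p)) (λ p → h₁≢h₂ (sym p))
                                                              (λ p → rim≢h₂ 2 (sym p)))
                                          (spoke₂ j)
          ; spokes₁-ahead  = λ j 2<j j<k →
              trans (walk₂-keepsˡ G h₁ (ν-distinct⁻ (<-trans (s≤s z≤n) 2<j) j<k) (rim≢h₁ j) (ν-distinct⁻ 2<j j<k))
                    (spoke₁ j)
          ; first-rim-edge = trans (walk₂-keepsˡ G s (ν-distinct⁻ (s≤s z≤n) 1<k) (rim≢h₁ 1) (ν-distinct (n<1+n 1) 2<k))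
                                   (trans (symmetric (ν 1) (ν 0)) (rim-edge 0))
          ; phase          = at-two refl (delete-removes-reversed (delete G s h₁) h₁ (ν 2))
          }

  -- Bob wins from a rim vertex, given the frame F starting there and its
  -- reflection F' (same start, opposite direction): Alice's openings to
  -- h₁, h₂, ν 1 and ν K are answered by the fan walk (with the hubs
  -- swapped for h₂) and the rim walk (along F' for ν K = ν' 1).
  rim-start : ∀ r₀ → r₀ + r₀ + 4 ≡ k → (F F' : Frame) →
              Frame.ν F' 0 ≡ Frame.ν F 0 → Frame.ν F' 1 ≡ Frame.ν F K →
              BobWins G (Frame.ν F 0)
  rim-start r₀ even F F' same-start reflected = losing-position answer
    where
      open Frame F
      open Strategy F r₀ even
      module Swapped   = Strategy (swap-hubs F) r₀ even
      module Reflected = Strategy F' r₀ even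
      answer : ∀ w → G s w ≡ true → Answered s G s w
      answer w e with rim-neighbours 0 w e
      ... | inj₁ refl               = (λ p → rim≢h₁ 0 (sym p)) , fan-walk
      ... | inj₂ (inj₁ refl)        = (λ p → rim≢h₂ 0 (sym p)) , Swapped.fan-walk
      ... | inj₂ (inj₂ (inj₁ refl)) = ν-distinct⁻ (s≤s z≤n) 1<k , rim-walk
      ... | inj₂ (inj₂ (inj₂ refl)) =
        ν-distinct⁻ (<-trans (s≤s z≤n) 2<K) (n<1+n K) ,
        subst₂ (λ x y → MoverWins x (delete G x y) y) same-start reflected Reflected.rim-walk

-- Ring identities for the index bookkeeping (checked by the ring solver).
-- Cancelling i modulo K + 1 by adding i K.
shift-identity : ∀ i x K → x + i * suc K ≡ i + x + i * K
shift-identity = solve-∀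

square-identity : ∀ x L → x * suc L * suc L ≡ x + x * L * suc (suc L)
square-identity = solve-∀

-- The backward reading t ↦ i + t K of the rim: its step, its step back,
-- and its period.
backward-next : ∀ i t K → i + suc t * K ≡ i + t * K + K
backward-next = solve-∀

backward-back : ∀ i t L → i + (t + suc L) * suc L ≡ suc (i + t * suc L) + L * suc (suc L)
backward-back = solve-∀

backward-period : ∀ i t K → i + (t + suc K) * K ≡ i + t * K + K * suc K
backward-period = solve-∀

double-even : ∀ r → r + r + 4 ≡ 2 * (2 + r)
double-even = solve-∀

module Residues (K : ℕ) where
  private
    k : ℕ
    k = suc K

  infix 4 _≡ₖ_
  _≡ₖ_ : ℕ → ℕ → Set
  x ≡ₖ y = x % k ≡ y % k

  +-congʳ-mod : ∀ x y z → x ≡ₖ y → x + z ≡ₖ y + z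
  +-congʳ-mod x y z x≡y = begin
    (x + z) % k              ≡⟨ %-distribˡ-+ x z k ⟩
    (x % k + z % k) % k      ≡⟨ cong (λ t → (t + z % k) % k) x≡y ⟩
    (y % k + z % k) % k      ≡⟨ %-distribˡ-+ y z k ⟨
    (y + z) % k              ∎
    where open ≡-Reasoning

  *-congʳ-mod : ∀ x y z → x ≡ₖ y → x * z ≡ₖ y * z
  *-congʳ-mod x y z x≡y = begin
    (x * z) % k              ≡⟨ %-distribˡ-* x z k ⟩
    (x % k * (z % k)) % k    ≡⟨ cong (λ t → (t * (z % k)) % k) x≡y ⟩
    (y % k * (z % k)) % k    ≡⟨ %-distribˡ-* y z k ⟨
    (y * z) % k              ∎
    where open ≡-Reasoning

  +-multiple : ∀ x c → x + c * k ≡ₖ x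
  +-multiple x c = [m+kn]%n≡m%n x c k

  +-cancelˡ-mod : ∀ i a b → i + a ≡ₖ i + b → a ≡ₖ b
  +-cancelˡ-mod i a b i+a≡i+b = begin
    a % k                    ≡⟨ +-multiple a i ⟨
    (a + i * k) % k          ≡⟨ cong (_% k) (shift-identity i a K) ⟩
    (i + a + i * K) % k      ≡⟨ +-congʳ-mod (i + a) (i + b) (i * K) i+a≡i+b ⟩
    (i + b + i * K) % k      ≡⟨ cong (_% k) (shift-identity i b K) ⟨
    (b + i * k) % k          ≡⟨ +-multiple b i ⟩
    b % k                    ∎
    where open ≡-Reasoning

  residue-injective : ∀ a b → a < k → b < k → a ≡ₖ b → a ≡ b
  residue-injective a b a<k b<k a≡b = trans (sym (m<n⇒m%n≡m a<k)) (trans a≡b (m<n⇒m%n≡m b<k))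

-- The double wheel of Defs with rim length k = L + 2.
module ConcreteWheel (L : ℕ) where
  K : ℕ
  K = suc L

  open DoubleWheelStrategy (_≟DW_ {suc K}) (doubleWheel (suc K)) K
  open FeedbackGame (_≟DW_ {k})
  open GameFacts (_≟DW_ {k})
  open Residues K

  G : EdgeSet (DWVertex k)
  G = doubleWheel k

  -- K ≡ −1, so multiplication by K is an involution modulo k.
  K²≡1 : ∀ x → x * K * K ≡ₖ x
  K²≡1 x = trans (cong (_% k) (square-identity x L)) (+-multiple x (x * L))

  position : ℕ → Fin k
  position n = fromℕ< (m%n<n n k)

  rimAt : ℕ → DWVertex k
  rimAt n = rim (position n)

  -- The index of a rim vertex (hubs get a dummy index).
  index : DWVertex k → ℕ
  index (rim f) = toℕ f
  index hubX    = 0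
  index hubY    = 0

  index-rimAt : ∀ n → index (rimAt n) ≡ n % k
  index-rimAt n = toℕ-fromℕ< (m%n<n n k)

  rimAt-cong : ∀ m n → m ≡ₖ n → rimAt m ≡ rimAt n
  rimAt-cong m n m≡n = cong rim (toℕ-injective (trans (index-rimAt m) (trans m≡n (sym (index-rimAt n)))))

  rimAt-mod : ∀ m n → rimAt m ≡ rimAt n → m ≡ₖ n
  rimAt-mod m n e = trans (sym (index-rimAt m)) (trans (cong index e) (index-rimAt n))

  rim-as-rimAt : ∀ f n → toℕ f ≡ n % k → rim f ≡ rimAt n
  rim-as-rimAt f n e = cong rim (toℕ-injective (trans e (sym (index-rimAt n))))

  isSucc-complete : ∀ (i j : Fin k) → toℕ j ≡ (toℕ i + 1) % k → isSucc i j ≡ true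
  isSucc-complete i j e = ⌊⌋-true (toℕ j ℕ.≟ (toℕ i + 1) % k) e

  isSucc-sound : ∀ (i j : Fin k) → isSucc i j ≡ true → toℕ j ≡ (toℕ i + 1) % k
  isSucc-sound i j e with toℕ j ℕ.≟ (toℕ i + 1) % k
  ... | yes p = p
  isSucc-sound i j () | no _

  successor-index : ∀ n → (index (rimAt n) + 1) % k ≡ suc n % k
  successor-index n = begin
    (index (rimAt n) + 1) % k  ≡⟨ cong (λ t → (t + 1) % k) (index-rimAt n) ⟩
    (n % k + 1) % k            ≡⟨ +-congʳ-mod (n % k) n 1 (m%n%n≡m%n n k) ⟩
    (n + 1) % k                ≡⟨ cong (_% k) (+-comm n 1) ⟩
    suc n % k                  ∎
    where open ≡-Reasoning

  symmetric : Symmetric G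
  symmetric (rim i) (rim j) = ∨-comm (isSucc i j) (isSucc j i)
  symmetric (rim i) hubX    = refl
  symmetric (rim i) hubY    = refl
  symmetric hubX    (rim j) = refl
  symmetric hubX    hubX    = refl
  symmetric hubX    hubY    = refl
  symmetric hubY    (rim j) = refl
  symmetric hubY    hubX    = refl
  symmetric hubY    hubY    = refl

  successor-edge : ∀ n → G (rimAt n) (rimAt (suc n)) ≡ true
  successor-edge n = cong (_∨ isSucc (position (suc n)) (position n))
    (isSucc-complete (position n) (position (suc n)) (trans (index-rimAt (suc n)) (sym (successor-index n))))

  predecessor-edge : ∀ n → G (rimAt n) (rimAt (n + K)) ≡ true
  predecessor-edge n = trans (symmetric (rimAt n) (rimAt (n + K)))
    (subst (λ v → G (rimAt (n + K)) v ≡ true) (rimAt-cong (suc (n + K)) n once-around) (successor-edge (n + K)))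
    where
      once-around : suc (n + K) ≡ₖ n
      once-around = trans (cong (_% k) (sym (+-suc n K))) ([m+n]%n≡m%n n k)

  rim-neighbours-at : ∀ n f → G (rimAt n) (rim f) ≡ true → rim f ≡ rimAt (suc n) ⊎ rim f ≡ rimAt (n + K)
  rim-neighbours-at n f e with isSucc (position n) f in forward
  ... | true  = inj₁ (rim-as-rimAt f (suc n) (trans (isSucc-sound (position n) f forward) (successor-index n)))
  ... | false = inj₂ (rim-as-rimAt f (n + K) (sym (begin
    (n + K) % k              ≡⟨ +-congʳ-mod n (toℕ f + 1) K (trans (sym (index-rimAt n)) (isSucc-sound f (position n) e)) ⟩
    (toℕ f + 1 + K) % k      ≡⟨ cong (_% k) (+-assoc (toℕ f) 1 K) ⟩
    (toℕ f + k) % k          ≡⟨ [m+n]%n≡m%n (toℕ f) k ⟩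
    toℕ f % k                ≡⟨ m<n⇒m%n≡m (toℕ<n f) ⟩
    toℕ f                    ∎)))
    where open ≡-Reasoning

  Steps : (ℕ → ℕ) → Set
  Steps ρ = ∀ t → (ρ (suc t) ≡ₖ suc (ρ t) × ρ (t + K) ≡ₖ ρ t + K)
                ⊎ (ρ (suc t) ≡ₖ ρ t + K × ρ (t + K) ≡ₖ suc (ρ t))

  frame-along : (ρ : ℕ → ℕ) → (∀ t → ρ (t + k) ≡ₖ ρ t) →
                (∀ a b → a < k → b < k → ρ a ≡ₖ ρ b → a ≡ b) → Steps ρ → Frame
  frame-along ρ periodic injective steps = record
    { h₁ = hubX ; h₂ = hubY ; ν = ν
    ; h₁≢h₂ = λ () ; rim≢h₁ = λ _ () ; rim≢h₂ = λ _ ()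
    ; periodic = λ t → rimAt-cong (ρ (t + k)) (ρ t) (periodic t)
    ; injective = λ {a} {b} a<k b<k e → injective a b a<k b<k (rimAt-mod (ρ a) (ρ b) e)
    ; symmetric = symmetric
    ; rim-edge = rim-edge
    ; spoke₁ = λ _ → refl ; spoke₂ = λ _ → refl
    ; rim-neighbours = neighbours
    }
    where
      ν : ℕ → DWVertex k
      ν t = rimAt (ρ t)
      rim-edge : ∀ t → G (ν t) (ν (suc t)) ≡ true
      rim-edge t with steps t
      ... | inj₁ (next , _) = subst (λ v → G (ν t) v ≡ true) (rimAt-cong (suc (ρ t)) (ρ (suc t)) (sym next))
                                    (successor-edge (ρ t))
      ... | inj₂ (next , _) = subst (λ v → G (ν t) v ≡ true) (rimAt-cong (ρ t + K) (ρ (suc t)) (sym next))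
                                    (predecessor-edge (ρ t))
      neighbours : ∀ t w → G (ν t) w ≡ true → w ≡ hubX ⊎ w ≡ hubY ⊎ w ≡ ν (suc t) ⊎ w ≡ ν (t + K)
      neighbours t hubX    _ = inj₁ refl
      neighbours t hubY    _ = inj₂ (inj₁ refl)
      neighbours t (rim f) e with rim-neighbours-at (ρ t) f e | steps t
      ... | inj₁ p | inj₁ (next , _) = inj₂ (inj₂ (inj₁ (trans p (rimAt-cong (suc (ρ t)) (ρ (suc t)) (sym next)))))
      ... | inj₂ p | inj₁ (_ , back) = inj₂ (inj₂ (inj₂ (trans p (rimAt-cong (ρ t + K) (ρ (t + K)) (sym back)))))
      ... | inj₁ p | inj₂ (_ , back) = inj₂ (inj₂ (inj₂ (trans p (rimAt-cong (suc (ρ t)) (ρ (t + K)) (sym back)))))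
      ... | inj₂ p | inj₂ (next , _) = inj₂ (inj₂ (inj₁ (trans p (rimAt-cong (ρ t + K) (ρ (suc t)) (sym next)))))

  forward-frame : ℕ → Frame
  forward-frame i = frame-along (i +_)
    (λ t → trans (cong (_% k) (sym (+-assoc i t k))) ([m+n]%n≡m%n (i + t) k))
    (λ a b a<k b<k e → residue-injective a b a<k b<k (+-cancelˡ-mod i a b e))
    (λ t → inj₁ (cong (_% k) (+-suc i t) , cong (_% k) (sym (+-assoc i t K))))

  -- Reading the rim backwards from index i (K ≡ −1 modulo k).
  backward-frame : ℕ → Frame
  backward-frame i = frame-along (λ t → i + t * K)
    (λ t → trans (cong (_% k) (backward-period i t K)) (+-multiple (i + t * K) K))
    (λ a b a<k b<k e → residue-injective a b a<k b<k (begin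
        a % k              ≡⟨ K²≡1 a ⟨
        (a * K * K) % k    ≡⟨ *-congʳ-mod (a * K) (b * K) K (+-cancelˡ-mod i (a * K) (b * K) e) ⟩
        (b * K * K) % k    ≡⟨ K²≡1 b ⟩
        b % k              ∎))
    (λ t → inj₂ (cong (_% k) (backward-next i t K) ,
                 trans (cong (_% k) (backward-back i t L)) (+-multiple (suc (i + t * K)) L)))
    where open ≡-Reasoning

  data Hub : DWVertex k → Set where
    x-hub : Hub hubX
    y-hub : Hub hubY

  data OnRim : DWVertex k → Set where
    on-rim : ∀ f → OnRim (rim f)

  -- The hubs are twins: their neighbours lie on the rim, and every rim
  -- vertex is joined to both hubs.
  hub-neighbour : ∀ {h} → Hub h → ∀ w → G h w ≡ true → OnRim w
  hub-neighbour _     (rim f) _ = on-rim f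
  hub-neighbour x-hub hubX    ()
  hub-neighbour x-hub hubY    ()
  hub-neighbour y-hub hubX    ()
  hub-neighbour y-hub hubY    ()

  rim-between : ∀ {h h' w} → Hub h → Hub h' → OnRim w → CommonNeighbour G h h' w
  rim-between x-hub x-hub (on-rim f) = (λ ()) , (λ ()) , refl , refl
  rim-between x-hub y-hub (on-rim f) = (λ ()) , (λ ()) , refl , refl
  rim-between y-hub x-hub (on-rim f) = (λ ()) , (λ ()) , refl , refl
  rim-between y-hub y-hub (on-rim f) = (λ ()) , (λ ()) , refl , refl

  hub-start : ∀ {h h'} → Hub h → Hub h' → h ≢ h' → BobWins G h
  hub-start hh hh' h≢h' =
    twin-start h≢h' (λ w e → rim-between hh hh' (hub-neighbour hh w e))
                    (λ w e → rim-between hh hh' (hub-neighbour hh' w e))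

  bob-wins : ∀ r₀ → r₀ + r₀ + 4 ≡ k → ∀ s → BobWins G s
  bob-wins r₀ even hubX    = hub-start x-hub y-hub (λ ())
  bob-wins r₀ even hubY    = hub-start y-hub x-hub (λ ())
  bob-wins r₀ even (rim f) =
    subst (BobWins G) start (rim-start r₀ even (forward-frame i) (backward-frame i) refl turn)
    where
      i : ℕ
      i = toℕ f
      start : rimAt (i + 0) ≡ rim f
      start = sym (rim-as-rimAt f (i + 0) (trans (sym (m<n⇒m%n≡m (toℕ<n f))) (cong (_% k) (sym (+-identityʳ i)))))
      turn : rimAt (i + 1 * K) ≡ rimAt (i + K)
      turn = cong (λ t → rimAt (i + t)) (+-identityʳ K)

-- For m = r₀ + 2 the rim length 2 m = 2 r₀ + 4 is L + 2 with L = r₀ + (r₀ + 2).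
proposition2p5 : (m : ℕ) → 2 ≤ m → (s : DWVertex (2 * m)) →
                   FeedbackGame.BobWins _≟DW_ (doubleWheel (2 * m)) s
proposition2p5 (suc (suc r₀)) (s≤s (s≤s z≤n)) =
  ConcreteWheel.bob-wins (r₀ + suc (suc (r₀ + 0))) r₀ (double-even r₀)
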